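{- Let $G=(V,E)$ be a finite graph and let $G'=(V',E')$ be a subgraph of $G$. Then $\mu(G')\leq \mu(G)$.
   Context: Graphs are finite, undirected, without loops or multiple edges. An independence system on a finite set $S$ is a family $\mathcal{I}$ of subsets of $S$ with $\emptyset\in\mathcal{I}$ that is closed under taking subsets; it is a matroid if for every $A\subseteq S$ all maximal members of $\mathcal{I}$ contained in $A$ have the same cardinality. For matroids $\mathcal{M}_1,\dots,\mathcal{M}_m$ on $S$, their intersection is $\mathcal{M}_1\cap\dots\cap\mathcal{M}_m$. For a graph $G=(V,E)$, a matching is a set of pairwise disjoint edges, and $M(G)$ denotes the independence system on $E$ consisting of all matchings of $G$. Define $\mu(G)=\min\{m\in\mathbb{N}: M(G)\text{ is the intersection of } m \text{ matroids on } E\}$. -}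

module Defs where

open import Data.Nat using (ℕ)
open import Data.Fin using (Fin)
open import Data.Fin.Subset using (Subset; _∈_; _⊆_; ⊥; ∣_∣)
open import Data.Product using (_×_; Σ; proj₁; proj₂)
open import Data.Sum using (_⊎_)
open import Relation.Binary.PropositionalEquality using (_≡_; _≢_)

-- A finite simple graph: vertices Fin n, edges Fin m, each edge e has two
-- distinct endpoints (end₁ e, end₂ e) (no loops), and two edges with the
-- same unordered pair of endpoints are equal (no multiple edges).
record Graph : Set where
  field
    n    : ℕ
    m    : ℕ
    end₁ : Fin m → Fin n
    end₂ : Fin m → Fin n
    loopless : ∀ e → end₁ e ≢ end₂ e
    simple   : ∀ e f →
      ((end₁ e ≡ end₁ f × end₂ e ≡ end₂ f) ⊎ (end₁ e ≡ end₂ f × end₂ e ≡ end₁ f)) →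
      e ≡ f

open Graph public

Incident : (G : Graph) → Fin (n G) → Fin (m G) → Set
Incident G v e = (v ≡ end₁ G e) ⊎ (v ≡ end₂ G e)

record Subgraph (G : Graph) : Set where
  field
    V' : Subset (n G)
    E' : Subset (m G)
    closed : ∀ e → e ∈ E' → end₁ G e ∈ V' × end₂ G e ∈ V'

IsMatching : (G : Graph) → Subset (m G) → Set
IsMatching G X = ∀ e f → e ∈ X → f ∈ X → e ≢ f →
  ∀ v → Incident G v e → Incident G v f → Data.Empty.⊥
  where import Data.Empty

Family : ℕ → Set₁
Family k = Subset k → Set

IsIndependenceSystemOn : ∀ {k} → Subset k → Family k → Set
IsIndependenceSystemOn S I =
  (∀ X → I X → X ⊆ S) × I ⊥ × (∀ X Y → Y ⊆ X → I X → I Y)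

MaximalIn : ∀ {k} → Family k → Subset k → Subset k → Set
MaximalIn I A B = I B × B ⊆ A × (∀ C → I C → B ⊆ C → C ⊆ A → C ⊆ B)

IsMatroidOn : ∀ {k} → Subset k → Family k → Set
IsMatroidOn S I = IsIndependenceSystemOn S I ×
  (∀ A → A ⊆ S → ∀ B₁ B₂ → MaximalIn I A B₁ → MaximalIn I A B₂ → ∣ B₁ ∣ ≡ ∣ B₂ ∣)

-- The matching system of the graph (V', E') living inside G, as a family on E':
-- all X ⊆ E' that are matchings.
MatchingSystem : (G : Graph) → Subset (m G) → Family (m G)
MatchingSystem G S X = X ⊆ S × IsMatching G X

IsIntersectionOf : ∀ {N} → Subset N → Family N → ℕ → Set₁
IsIntersectionOf {N} S I k = Σ (Fin k → Family N) λ M →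
  (∀ i → IsMatroidOn S (M i)) × (∀ X → X ⊆ S → (I X → ∀ i → M i X) × ((∀ i → M i X) → I X))

MatchingIntersectionOf : (G : Graph) → ℕ → Set₁
MatchingIntersectionOf G k = IsIntersectionOf Data.Fin.Subset.⊤ (MatchingSystem G Data.Fin.Subset.⊤) k

SubMatchingIntersectionOf : (G : Graph) → Subgraph G → ℕ → Set₁
SubMatchingIntersectionOf G H k =
  IsIntersectionOf (Subgraph.E' H) (MatchingSystem G (Subgraph.E' H)) k

{-# OPTIONS --safe #-}
module Submission where

open import Defs
open import Data.Nat using (ℕ; _≤_)
open import Data.Nat.Properties using (≤-refl)
open import Data.Product using (Σ; _×_; _,_; proj₁; proj₂)
open import Data.Fin.Subset using (Subset; _⊆_; ⊤)
open import Data.Fin.Subset.Properties using (⊆⊤; ⊥⊆; ⊆-trans)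

-- A matroid restricted to a subset of its ground set is again a matroid, and
-- restricting every matroid of an intersection representation of M(G) to E'
-- represents M(G'), with the same number of matroids.

restrict : ∀ {N} → Subset N → Family N → Family N
restrict S I X = X ⊆ S × I X

restrict-isIndependenceSystemOn : ∀ {N} {T : Subset N} {I : Family N} (S : Subset N) →
  IsIndependenceSystemOn T I → IsIndependenceSystemOn S (restrict S I)
restrict-isIndependenceSystemOn S (_ , I⊥ , I-down) =
    (λ _ → proj₁)
  , (⊥⊆ , I⊥)
  , λ X Y Y⊆X (X⊆S , IX) → ⊆-trans Y⊆X X⊆S , I-down X Y Y⊆X IX

maximalIn-restrict⇒maximalIn : ∀ {N} {S : Subset N} {I : Family N} {A B : Subset N} →
  A ⊆ S → MaximalIn (restrict S I) A B → MaximalIn I A B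
maximalIn-restrict⇒maximalIn A⊆S ((_ , IB) , B⊆A , maximal) =
  IB , B⊆A , λ C IC B⊆C C⊆A → maximal C (⊆-trans C⊆A A⊆S , IC) B⊆C C⊆A

restrict-isMatroidOn : ∀ {N} {T : Subset N} {I : Family N} (S : Subset N) →
  S ⊆ T → IsMatroidOn T I → IsMatroidOn S (restrict S I)
restrict-isMatroidOn S S⊆T (indep , equicardinal) =
    restrict-isIndependenceSystemOn S indep
  , λ A A⊆S B₁ B₂ max₁ max₂ →
      equicardinal A (⊆-trans A⊆S S⊆T) B₁ B₂
        (maximalIn-restrict⇒maximalIn A⊆S max₁)
        (maximalIn-restrict⇒maximalIn A⊆S max₂)

restrict-isIntersectionOf : ∀ {N} {T S : Subset N} {I J : Family N} {k : ℕ} →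
  S ⊆ T → (∀ X → X ⊆ S → (J X → I X) × (I X → J X)) →
  IsIntersectionOf T I k → IsIntersectionOf S J k
restrict-isIntersectionOf {S = S} S⊆T J⇔I (M , matroid , I⇔⋂M) =
    (λ i → restrict S (M i))
  , (λ i → restrict-isMatroidOn S S⊆T (matroid i))
  , λ X X⊆S →
      (λ JX i → X⊆S , proj₁ (I⇔⋂M X (⊆-trans X⊆S S⊆T)) (proj₁ (J⇔I X X⊆S) JX) i)
    , λ ⋂M'X → proj₂ (J⇔I X X⊆S)
                 (proj₂ (I⇔⋂M X (⊆-trans X⊆S S⊆T)) λ i → proj₂ (⋂M'X i))

matchingSystem-⊆ : (G : Graph) {S : Subset (m G)} (X : Subset (m G)) → X ⊆ S →
  (MatchingSystem G S X → MatchingSystem G ⊤ X) × (MatchingSystem G ⊤ X → MatchingSystem G S X)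
matchingSystem-⊆ G X X⊆S = (λ (_ , matching) → ⊆⊤ , matching)
                         , λ (_ , matching) → X⊆S , matching

lemma1 : (G : Graph) (H : Subgraph G) (k : ℕ) →
    MatchingIntersectionOf G k →
    Σ ℕ (λ k' → k' ≤ k × SubMatchingIntersectionOf G H k')
lemma1 G H k matchings=⋂M =
  k , ≤-refl , restrict-isIntersectionOf ⊆⊤ (matchingSystem-⊆ G) matchings=⋂M
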